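{- Let $b\in\mathbb{Q}$, $b\neq 0$, and let $\phi_b(z)=\dfrac{z}{2}+\dfrac{b}{z}$. Then $\phi_b$ has no point in $\mathbb{P}^1(\mathbb{Q})$ of least period $n>2$.
   Context: A point $\alpha$ has least period $n$ for $\phi$ if $\phi^n(\alpha)=\alpha$ and $\phi^k(\alpha)\ne\alpha$ for $0<k<n$. -}

module Defs where

open import Data.Nat using (ℕ; zero; suc)
open import Data.Rational using (ℚ; 0ℚ; ½; _+_; _*_; _÷_; ≢-nonZero)
open import Data.Rational.Properties using (_≟_)
open import Relation.Nullary using (yes; no)
open import Data.Product using (_×_)
open import Relation.Binary.PropositionalEquality using (_≡_; _≢_)
import Data.Nat

data ℙ¹ : Set where
  fin : ℚ → ℙ¹
  ∞   : ℙ¹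

φ : ℚ → ℙ¹ → ℙ¹
φ b ∞ = ∞
φ b (fin z) with z ≟ 0ℚ
... | yes _  = ∞
... | no z≢0 = fin (½ * z + _÷_ b z {{≢-nonZero z≢0}})

iter : ∀ {A : Set} → (A → A) → ℕ → A → A
iter f zero    x = x
iter f (suc n) x = f (iter f n x)

HasLeastPeriod : ∀ {A : Set} → (A → A) → A → ℕ → Set
HasLeastPeriod f α n =
  (0 Data.Nat.< n) × (iter f n α ≡ α) × (∀ k → 0 Data.Nat.< k → k Data.Nat.< n → iter f k α ≢ α)

{-# OPTIONS --safe #-}
-- φ_b(z) = (z² + c)/(2z), c = 2b, is Newton's map for z² − c. The substitution
-- u = (z − √c)/(z + √c) turns it into u ↦ u², and y = u + 1/u turns squaring into
-- f₋₂(y) = y² − 2. The composite τ(z) = 2(z² + c)/(z² − c) is defined over ℚ, satisfies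
-- τ ∘ φ_b = f₋₂ ∘ τ, and identifies exactly z with −z. Along an f₋₂-orbit denominators
-- get squared, so a rational periodic point of f₋₂ is an integer; integers above 2 (or,
-- by evenness, below −2) escape, and among −2, …, 2 only the fixed points 2 and −1 are
-- periodic. So if α is φ_b-periodic, τ(α) is fixed, hence φ_b(α) = ±α, and as φ_b is
-- odd, φ_b²(α) = α.
module Submission where

open import Data.Empty using (⊥-elim)
open import Data.List.Base using ([]; _∷_)
open import Data.Product using (_,_; ∃-syntax)
open import Data.Sum as Sum using (_⊎_; inj₁; inj₂; [_,_])
open import Function using (id; _∘_)
open import Level using (0ℓ)
open import Relation.Binary.PropositionalEquality
  using (_≡_; _≢_; refl; sym; trans; cong; cong₂; subst; module ≡-Reasoning)
open import Relation.Nullary using (¬_; yes; no)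
open import Relation.Nullary.Decidable using (dec⇒maybe)

open import Data.Nat as ℕ using (ℕ; zero; suc; s≤s; z≤n)
import Data.Nat.Properties as ℕ
open import Data.Nat.Coprimality as ℕ using (Coprime; coprime-divisor)
open import Data.Nat.Divisibility as ℕ using (∣-trans; ∣⇒≤)
import Data.Integer as ℤ
import Data.Integer.Properties as ℤ
import Data.Integer.Coprimality as ℤ
open import Data.Integer.Divisibility.Signed as ℤ using (divides; ∣⇒∣ᵤ)
import Data.Integer.Tactic.RingSolver as ℤ-Solver
open import Data.Rational
  using ( ℚ; mkℚ; 0ℚ; 1ℚ; ½; _+_; _*_; _-_; -_; 1/_; _÷_; _<_; _≤_; *<*; *≤*
        ; ↥_; ↧_; ↧ₙ_; toℚᵘ; ≢-nonZero; positive)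
open import Data.Rational.Properties
import Data.Rational.Unnormalised as ℚᵘ
import Data.Rational.Unnormalised.Properties as ℚᵘ
open import Algebra.Properties.Group +-0-group
  using (x∙y⁻¹≈ε⇒x≈y; x≈y⇒x∙y⁻¹≈ε; inverseˡ-unique; ⁻¹-involutive)
open import Tactic.RingSolver using (solve)
import Tactic.RingSolver.Core.AlmostCommutativeRing as ACR

open import Defs

-- With a zero test the solver can cancel vanishing coefficients.
ℚ-ring : ACR.AlmostCommutativeRing 0ℓ 0ℓ
ℚ-ring = ACR.fromCommutativeRing +-*-commutativeRing (dec⇒maybe ∘ (0ℚ ≟_))

2ℚ : ℚ
2ℚ = 1ℚ + 1ℚ

p*q≡0⇒p≡0∨q≡0 : ∀ p q → p * q ≡ 0ℚ → p ≡ 0ℚ ⊎ q ≡ 0ℚ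
p*q≡0⇒p≡0∨q≡0 p q pq≡0 with p ≟ 0ℚ
... | yes p≡0 = inj₁ p≡0
... | no p≢0 = inj₂ (begin
  q              ≡⟨ *-identityˡ q ⟨
  1ℚ * q         ≡⟨ cong (_* q) (*-inverseˡ p) ⟨
  1/ p * p * q   ≡⟨ *-assoc (1/ p) p q ⟩
  1/ p * (p * q) ≡⟨ cong (1/ p *_) pq≡0 ⟩
  1/ p * 0ℚ      ≡⟨ *-zeroʳ (1/ p) ⟩
  0ℚ             ∎)
  where
  open ≡-Reasoning
  instance _ = ≢-nonZero p≢0

p*q≢0 : ∀ {p q} → p ≢ 0ℚ → q ≢ 0ℚ → p * q ≢ 0ℚ
p*q≢0 {p} {q} p≢0 q≢0 = [ p≢0 , q≢0 ] ∘ p*q≡0⇒p≡0∨q≡0 p q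

p+p≡0⇒p≡0 : ∀ {p} → p + p ≡ 0ℚ → p ≡ 0ℚ
p+p≡0⇒p≡0 {p} p+p≡0 = begin
  p           ≡⟨ solve (p ∷ []) ℚ-ring ⟩
  ½ * (p + p) ≡⟨ cong (½ *_) p+p≡0 ⟩
  ½ * 0ℚ      ≡⟨ *-zeroʳ ½ ⟩
  0ℚ          ∎
  where open ≡-Reasoning

p+p≢0 : ∀ {p} → p ≢ 0ℚ → p + p ≢ 0ℚ
p+p≢0 p≢0 = p≢0 ∘ p+p≡0⇒p≡0

p*p≡q*q⇒p≡q∨p≡-q : ∀ p q → p * p ≡ q * q → p ≡ q ⊎ p ≡ - q
p*p≡q*q⇒p≡q∨p≡-q p q p²≡q² =
  Sum.map (x∙y⁻¹≈ε⇒x≈y p q) (inverseˡ-unique p q) (p*q≡0⇒p≡0∨q≡0 (p - q) (p + q) (begin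
    (p - q) * (p + q) ≡⟨ solve (p ∷ q ∷ []) ℚ-ring ⟩
    p * p - q * q     ≡⟨ x≈y⇒x∙y⁻¹≈ε p²≡q² ⟩
    0ℚ                ∎))
  where open ≡-Reasoning

module _ {A : Set} (f : A → A) where

  iter-comm : ∀ n x → iter f n (f x) ≡ f (iter f n x)
  iter-comm zero    x = refl
  iter-comm (suc n) x = cong f (iter-comm n x)

  iter-fixed : ∀ {y} → f y ≡ y → ∀ n → iter f n y ≡ y
  iter-fixed fy≡y zero    = refl
  iter-fixed fy≡y (suc n) = trans (cong f (iter-fixed fy≡y n)) fy≡y

  Periodic : A → Set
  Periodic x = ∃[ m ] iter f (suc m) x ≡ x

  periodic-image : ∀ {x} → Periodic x → Periodic (f x)
  periodic-image {x} (m , fᵐ⁺¹x≡x) = m , trans (iter-comm (suc m) x) (cong f fᵐ⁺¹x≡x)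

  ¬periodic-onto-fixed : ∀ {x y} → f x ≡ y → f y ≡ y → x ≢ y → ¬ Periodic x
  ¬periodic-onto-fixed {x} {y} fx≡y fy≡y x≢y (m , fᵐ⁺¹x≡x) = x≢y (begin
    x                ≡⟨ fᵐ⁺¹x≡x ⟨
    iter f (suc m) x ≡⟨ iter-comm m x ⟨
    iter f m (f x)   ≡⟨ cong (iter f m) fx≡y ⟩
    iter f m y       ≡⟨ iter-fixed fy≡y m ⟩
    y                ∎)
    where open ≡-Reasoning

  module _ (v : A → ℕ) (v-mono : ∀ y → v y ℕ.≤ v (f y)) where

    iter-mono : ∀ n y → v y ℕ.≤ v (iter f n y)
    iter-mono zero    y = ℕ.≤-refl
    iter-mono (suc n) y = ℕ.≤-trans (iter-mono n y) (v-mono (iter f n y))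

    periodic⇒¬increasing : ∀ {x} → Periodic x → ¬ (v x ℕ.< v (f x))
    periodic⇒¬increasing {x} (m , fᵐ⁺¹x≡x) =
      ℕ.≤⇒≯ (subst (λ y → v (f x) ℕ.≤ v y) (trans (iter-comm m x) fᵐ⁺¹x≡x) (iter-mono m (f x)))

module _ {A B : Set} {f : A → A} {g : B → B} (h : A → B) (h∘f≗g∘h : ∀ x → h (f x) ≡ g (h x)) where

  iter-semiconj : ∀ n x → h (iter f n x) ≡ iter g n (h x)
  iter-semiconj zero    x = refl
  iter-semiconj (suc n) x = trans (h∘f≗g∘h (iter f n x)) (cong g (iter-semiconj n x))

  periodic-semiconj : ∀ {x} → Periodic f x → Periodic g (h x)
  periodic-semiconj {x} (m , fᵐ⁺¹x≡x) = m , trans (sym (iter-semiconj (suc m) x)) (cong h fᵐ⁺¹x≡x)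

f₋₂ : ℚ → ℚ
f₋₂ y = y * y - 2ℚ

toℚᵘ-cross : ∀ {p u} → toℚᵘ p ℚᵘ.≃ u → ↥ p ℤ.* ℚᵘ.↧ u ≡ ℚᵘ.↥ u ℤ.* ↧ p
toℚᵘ-cross {mkℚ _ _ _} (ℚᵘ.*≡* eq) = eq

f₋₂-cross : ∀ x → ↥ x ℤ.* ↥ x ℤ.* ↧ (f₋₂ x) ≡ (↥ (f₋₂ x) ℤ.+ ℤ.+ 2 ℤ.* ↧ (f₋₂ x)) ℤ.* (↧ x ℤ.* ↧ x)
f₋₂-cross x@(mkℚ _ _ _) = rearrange {↥ x} {↧ x} {↥ (f₋₂ x)} {↧ (f₋₂ x)} (toℚᵘ-cross (ℚᵘ.≃-trans
  (toℚᵘ-homo-+ (x * x) (- 2ℚ)) (ℚᵘ.+-congˡ (toℚᵘ (- 2ℚ)) (toℚᵘ-homo-* x x))))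
  where
  open ≡-Reasoning
  rearrange : ∀ {p q p′ q′} →
              p′ ℤ.* (q ℤ.* q ℤ.* ℤ.+ 1) ≡ (p ℤ.* p ℤ.* ℤ.+ 1 ℤ.+ ℤ.-[1+ 1 ] ℤ.* (q ℤ.* q)) ℤ.* q′ →
              p ℤ.* p ℤ.* q′ ≡ (p′ ℤ.+ ℤ.+ 2 ℤ.* q′) ℤ.* (q ℤ.* q)
  rearrange {p} {q} {p′} {q′} eq = begin
    p ℤ.* p ℤ.* q′
      ≡⟨ ℤ-Solver.solve (p ∷ q ∷ q′ ∷ []) ⟩
    (p ℤ.* p ℤ.* ℤ.+ 1 ℤ.+ ℤ.-[1+ 1 ] ℤ.* (q ℤ.* q)) ℤ.* q′ ℤ.+ ℤ.+ 2 ℤ.* q′ ℤ.* (q ℤ.* q)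
      ≡⟨ cong (ℤ._+ _) eq ⟨
    p′ ℤ.* (q ℤ.* q ℤ.* ℤ.+ 1) ℤ.+ ℤ.+ 2 ℤ.* q′ ℤ.* (q ℤ.* q)
      ≡⟨ ℤ-Solver.solve (p′ ∷ q ∷ q′ ∷ []) ⟩
    (p′ ℤ.+ ℤ.+ 2 ℤ.* q′) ℤ.* (q ℤ.* q)
      ∎

coprime-* : ∀ {m n k} → Coprime m n → Coprime m k → Coprime m (n ℕ.* k)
coprime-* {m} {n} m⊥n m⊥k {d} (d∣m , d∣nk) = m⊥k (d∣m , coprime-divisor d⊥n d∣nk)
  where
  d⊥n : Coprime d n
  d⊥n (e∣d , e∣n) = m⊥n (∣-trans e∣d d∣m , e∣n)

coprime-squares : ∀ {m n} → Coprime m n → Coprime (m ℕ.* m) (n ℕ.* n)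
coprime-squares m⊥n = ℕ.sym (coprime-square (ℕ.sym (coprime-square m⊥n)))
  where
  coprime-square : ∀ {a b} → Coprime a b → Coprime a (b ℕ.* b)
  coprime-square a⊥b = coprime-* a⊥b a⊥b

↧²∣↧-f₋₂ : ∀ x → ↧ₙ x ℕ.* ↧ₙ x ℕ.∣ ↧ₙ (f₋₂ x)
↧²∣↧-f₋₂ x@(mkℚ p _ p⊥q) = ℤ.coprime-divisor (↧ x ℤ.* ↧ x) (p ℤ.* p) (↧ (f₋₂ x)) q²⊥p²
  (∣⇒∣ᵤ {↧ x ℤ.* ↧ x} (divides (↥ (f₋₂ x) ℤ.+ ℤ.+ 2 ℤ.* ↧ (f₋₂ x)) (f₋₂-cross x)))
  where
  q²⊥p² : ℤ.Coprime (↧ x ℤ.* ↧ x) (p ℤ.* p)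
  q²⊥p² = subst (Coprime _) (sym (ℤ.abs-* p p)) (coprime-squares (ℕ.sym (ℕ.recompute p⊥q)))

↧-f₋₂-mono : ∀ x → ↧ₙ x ℕ.≤ ↧ₙ (f₋₂ x)
↧-f₋₂-mono x = ℕ.≤-trans (ℕ.m≤m*n (↧ₙ x) (↧ₙ x)) (∣⇒≤ (↧²∣↧-f₋₂ x))

↧-f₋₂-strict : ∀ x → 1 ℕ.< ↧ₙ x → ↧ₙ x ℕ.< ↧ₙ (f₋₂ x)
↧-f₋₂-strict x 1<q = ℕ.<-≤-trans (ℕ.m<m*n (↧ₙ x) (↧ₙ x) 1<q) (∣⇒≤ (↧²∣↧-f₋₂ x))

periodic⇒integer : ∀ {x} → Periodic f₋₂ x → ↧ₙ x ℕ.≤ 1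
periodic⇒integer {x} per = ℕ.≮⇒≥ (periodic⇒¬increasing f₋₂ ↧ₙ_ ↧-f₋₂-mono per ∘ ↧-f₋₂-strict x)

f₋₂-increasing : ∀ {y} → 2ℚ < y → y < f₋₂ y
f₋₂-increasing {y} 2<y = begin-strict
  y               ≡⟨ solve (y ∷ []) ℚ-ring ⟩
  y + 2ℚ - 2ℚ     <⟨ +-monoˡ-< (- 2ℚ) (begin-strict
    y + 2ℚ          <⟨ +-monoʳ-< y 2<y ⟩
    y + y           ≡⟨ solve (y ∷ []) ℚ-ring ⟩
    y * 2ℚ          <⟨ *-monoʳ-<-pos y 2<y ⟩
    y * y           ∎) ⟩
  y * y - 2ℚ      ∎
  where
  open ≤-Reasoning
  instance _ = positive (<-trans (*<* (ℤ.+<+ (s≤s z≤n))) 2<y)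

f₋₂-escapes : ∀ m {y} → 2ℚ < y → y < iter f₋₂ (suc m) y
f₋₂-escapes zero    2<y = f₋₂-increasing 2<y
f₋₂-escapes (suc m) 2<y = <-trans y<fᵐ⁺¹y (f₋₂-increasing (<-trans 2<y y<fᵐ⁺¹y))
  where y<fᵐ⁺¹y = f₋₂-escapes m 2<y

f₋₂-even : ∀ y → f₋₂ (- y) ≡ f₋₂ y
f₋₂-even y = begin
  - y * - y - 2ℚ ≡⟨ solve (y ∷ []) ℚ-ring ⟩
  y * y - 2ℚ     ∎
  where open ≡-Reasoning

periodic⇒≤2 : ∀ {y} → Periodic f₋₂ y → y ≤ 2ℚ
periodic⇒≤2 {y} (m , fᵐ⁺¹y≡y) = ≮⇒≥ (λ 2<y → <-irrefl (sym fᵐ⁺¹y≡y) (f₋₂-escapes m 2<y))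

periodic⇒≥-2 : ∀ {y} → Periodic f₋₂ y → - 2ℚ ≤ y
periodic⇒≥-2 {y} per = ≮⇒≥ λ y<-2 →
  <-irrefl refl (≤-<-trans (periodic⇒≤2 (periodic-image f₋₂ per)) (begin-strict
  2ℚ         <⟨ neg-antimono-< y<-2 ⟩
  - y        <⟨ f₋₂-increasing (neg-antimono-< y<-2) ⟩
  f₋₂ (- y)  ≡⟨ f₋₂-even y ⟩
  f₋₂ y      ∎))
  where open ≤-Reasoning

-- 0 ↦ −2 ↦ 2 ↦ 2 and 1 ↦ −1 ↦ −1.
integer-periodic⇒fixed : ∀ y → ↧ₙ y ℕ.≤ 1 → - 2ℚ ≤ y → y ≤ 2ℚ → Periodic f₋₂ y → f₋₂ y ≡ y
integer-periodic⇒fixed (mkℚ (ℤ.+ 0) 0 _) _ _ _ per =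
  ⊥-elim (¬periodic-onto-fixed f₋₂ refl refl (λ ()) (periodic-image f₋₂ per))
integer-periodic⇒fixed (mkℚ (ℤ.+ 1) 0 _) _ _ _ per = ⊥-elim (¬periodic-onto-fixed f₋₂ refl refl (λ ()) per)
integer-periodic⇒fixed (mkℚ (ℤ.+ 2) 0 _) _ _ _ _ = refl
integer-periodic⇒fixed (mkℚ (ℤ.+ suc (suc (suc _))) 0 _) _ _ (*≤* (ℤ.+≤+ (s≤s (s≤s ())))) _
integer-periodic⇒fixed (mkℚ ℤ.-[1+ 0 ] 0 _) _ _ _ _ = refl
integer-periodic⇒fixed (mkℚ ℤ.-[1+ 1 ] 0 _) _ _ _ per = ⊥-elim (¬periodic-onto-fixed f₋₂ refl refl (λ ()) per)
integer-periodic⇒fixed (mkℚ ℤ.-[1+ suc (suc _) ] 0 _) _ (*≤* (ℤ.-≤- (s≤s ()))) _ _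
integer-periodic⇒fixed (mkℚ _ (suc _) _) (s≤s ()) _ _ _

f₋₂-periodic⇒fixed : ∀ y → Periodic f₋₂ y → f₋₂ y ≡ y
f₋₂-periodic⇒fixed y per =
  integer-periodic⇒fixed y (periodic⇒integer per) (periodic⇒≥-2 per) (periodic⇒≤2 per) per

fin-injective : ∀ {x y} → fin x ≡ fin y → x ≡ y
fin-injective refl = refl

extend : (ℚ → ℚ) → ℙ¹ → ℙ¹
extend f ∞       = ∞
extend f (fin x) = fin (f x)

extend-periodic⇒fixed : ∀ {f} → (∀ x → Periodic f x → f x ≡ x) →
                        ∀ P → Periodic (extend f) P → extend f P ≡ P
extend-periodic⇒fixed fixed ∞       _              = refl
extend-periodic⇒fixed {f} fixed (fin x) (m , fᵐ⁺¹x≡x) =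
  cong fin (fixed x (m , fin-injective
    (trans (iter-semiconj {f = f} {g = extend f} fin (λ _ → refl) (suc m) x) fᵐ⁺¹x≡x)))

-- The point [p : q]; the degenerate 0 ⊘ 0 is ∞.
infix 5 _⊘_
_⊘_ : ℚ → ℚ → ℙ¹
p ⊘ q with q ≟ 0ℚ
... | yes _   = ∞
... | no q≢0 = fin (_÷_ p q {{≢-nonZero q≢0}})

data Quotient (p q : ℚ) : ℙ¹ → Set where
  pole  : q ≡ 0ℚ → Quotient p q ∞
  value : ∀ t → q ≢ 0ℚ → t * q ≡ p → Quotient p q (fin t)

quotient : ∀ p q → Quotient p q (p ⊘ q)
quotient p q with q ≟ 0ℚ
... | yes q≡0 = pole q≡0
... | no q≢0 = value _ q≢0 (begin
  p * 1/ q * q   ≡⟨ *-assoc p (1/ q) q ⟩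
  p * (1/ q * q) ≡⟨ cong (p *_) (*-inverseˡ q) ⟩
  p * 1ℚ         ≡⟨ *-identityʳ p ⟩
  p              ∎)
  where
  open ≡-Reasoning
  instance _ = ≢-nonZero q≢0

⊘-pole : ∀ {p q} → q ≡ 0ℚ → p ⊘ q ≡ ∞
⊘-pole {p} {q} q≡0 with p ⊘ q | quotient p q
... | ∞     | pole _        = refl
... | fin _ | value _ q≢0 _ = ⊥-elim (q≢0 q≡0)

⊘-value : ∀ {p q t} → q ≢ 0ℚ → t * q ≡ p → p ⊘ q ≡ fin t
⊘-value {p} {q} {t} q≢0 tq≡p with q ≟ 0ℚ
... | yes q≡0 = ⊥-elim (q≢0 q≡0)
... | no q≢0 = cong fin (begin
  p * 1/ q       ≡⟨ cong (_* 1/ q) tq≡p ⟨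
  t * q * 1/ q   ≡⟨ *-assoc t q (1/ q) ⟩
  t * (q * 1/ q) ≡⟨ cong (t *_) (*-inverseʳ q) ⟩
  t * 1ℚ         ≡⟨ *-identityʳ t ⟩
  t              ∎)
  where
  open ≡-Reasoning
  instance _ = ≢-nonZero q≢0

⊘-cross : ∀ {p q p′ q′} → p ⊘ q ≡ p′ ⊘ q′ → p * q′ ≡ p′ * q
⊘-cross {p} {q} {p′} {q′} eq with p ⊘ q | quotient p q | p′ ⊘ q′ | quotient p′ q′
... | ∞ | pole refl | ∞ | pole refl = trans (*-zeroʳ p) (sym (*-zeroʳ p′))
... | fin t | value t _ refl | fin t′ | value t′ _ refl with refl ← eq = solve (t ∷ q ∷ q′ ∷ []) ℚ-ring
... | ∞     | _              | fin _  | _               with () ← eq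
... | fin _ | _              | ∞      | _               with () ← eq

⊘-scale : ∀ {s} p q → s ≢ 0ℚ → (s * p) ⊘ (s * q) ≡ p ⊘ q
⊘-scale {s} p q s≢0 with p ⊘ q | quotient p q
... | ∞     | pole refl          = ⊘-pole (*-zeroʳ s)
... | fin t | value t q≢0 refl = ⊘-value (p*q≢0 s≢0 q≢0) (solve (s ∷ t ∷ q ∷ []) ℚ-ring)

neg : ℙ¹ → ℙ¹
neg ∞       = ∞
neg (fin z) = fin (- z)

neg-involutive : ∀ P → neg (neg P) ≡ P
neg-involutive ∞       = refl
neg-involutive (fin z) = cong fin (⁻¹-involutive z)

neg-⊘ : ∀ p q → neg (p ⊘ q) ≡ p ⊘ - q
neg-⊘ p q with p ⊘ q | quotient p q
... | ∞     | pole refl          = sym (⊘-pole {p} refl)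
... | fin t | value t q≢0 refl = sym (⊘-value (q≢0 ∘ neg-injective) (solve (t ∷ q ∷ []) ℚ-ring))

f₋₂-⊘ : ∀ p q → extend f₋₂ (p ⊘ q) ≡ (p * p - 2ℚ * (q * q)) ⊘ (q * q)
f₋₂-⊘ p q with p ⊘ q | quotient p q
... | ∞     | pole refl          = sym (⊘-pole {p * p - 2ℚ * (0ℚ * 0ℚ)} refl)
... | fin t | value t q≢0 refl = sym (⊘-value (p*q≢0 q≢0 q≢0) (solve (t ∷ q ∷ []) ℚ-ring))

τ : ℚ → ℙ¹ → ℙ¹
τ c ∞       = fin 2ℚ
τ c (fin z) = 2ℚ * (z * z + c) ⊘ (z * z - c)

τ-⊘ : ∀ c p q → (q ≡ 0ℚ → p ≢ 0ℚ) →
      τ c (p ⊘ q) ≡ 2ℚ * (p * p + c * (q * q)) ⊘ (p * p - c * (q * q))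
τ-⊘ c p q nondegenerate with p ⊘ q | quotient p q
... | ∞ | pole refl = begin
  fin 2ℚ
    ≡⟨ ⊘-value (p*q≢0 p≢0 p≢0) refl ⟨
  2ℚ * (p * p) ⊘ p * p
    ≡⟨ cong₂ _⊘_ (solve (c ∷ p ∷ []) ℚ-ring) (solve (c ∷ p ∷ []) ℚ-ring) ⟩
  2ℚ * (p * p + c * (0ℚ * 0ℚ)) ⊘ (p * p - c * (0ℚ * 0ℚ))
    ∎
  where
  open ≡-Reasoning
  p≢0 = nondegenerate refl
... | fin t | value t q≢0 refl = begin
  2ℚ * (t * t + c) ⊘ (t * t - c)
    ≡⟨ ⊘-scale _ _ (p*q≢0 q≢0 q≢0) ⟨
  q * q * (2ℚ * (t * t + c)) ⊘ q * q * (t * t - c)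
    ≡⟨ cong₂ _⊘_ (solve (c ∷ t ∷ q ∷ []) ℚ-ring) (solve (c ∷ t ∷ q ∷ []) ℚ-ring) ⟩
  2ℚ * (t * q * (t * q) + c * (q * q)) ⊘ (t * q * (t * q) - c * (q * q))
    ∎
  where open ≡-Reasoning

newton : ℚ → ℚ → ℙ¹
newton c z = z * z + c ⊘ z + z

φ-newton : ∀ b z → φ b (fin z) ≡ newton (b + b) z
φ-newton b z with z ≟ 0ℚ
... | yes refl = sym (⊘-pole {0ℚ * 0ℚ + (b + b)} refl)
... | no z≢0  = sym (⊘-value (p+p≢0 z≢0) (numerator b z (1/ z) (*-inverseʳ z)))
  where
  instance _ = ≢-nonZero z≢0
  numerator : ∀ b z z⁻¹ → z * z⁻¹ ≡ 1ℚ → (½ * z + b * z⁻¹) * (z + z) ≡ z * z + (b + b)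
  numerator b z z⁻¹ zz⁻¹≡1 = begin
    (½ * z + b * z⁻¹) * (z + z)   ≡⟨ solve (b ∷ z ∷ z⁻¹ ∷ []) ℚ-ring ⟩
    z * z + (b + b) * (z * z⁻¹)   ≡⟨ cong (λ u → z * z + (b + b) * u) zz⁻¹≡1 ⟩
    z * z + (b + b) * 1ℚ          ≡⟨ cong (z * z +_) (*-identityʳ (b + b)) ⟩
    z * z + (b + b)               ∎
    where open ≡-Reasoning

newton-odd : ∀ c z → newton c (- z) ≡ neg (newton c z)
newton-odd c z = begin
  - z * - z + c ⊘ - z + - z   ≡⟨ cong₂ _⊘_ (solve (c ∷ z ∷ []) ℚ-ring) (solve (z ∷ []) ℚ-ring) ⟩
  z * z + c ⊘ - (z + z)       ≡⟨ neg-⊘ _ _ ⟨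
  neg (z * z + c ⊘ z + z)     ∎
  where open ≡-Reasoning

τ-newton : ∀ {c} → c ≢ 0ℚ → ∀ z → τ c (newton c z) ≡ extend f₋₂ (τ c (fin z))
τ-newton {c} c≢0 z = begin
  τ c (z * z + c ⊘ z + z)
    ≡⟨ τ-⊘ c _ _ nondegenerate ⟩
  2ℚ * ((z * z + c) * (z * z + c) + c * ((z + z) * (z + z)))
    ⊘ (z * z + c) * (z * z + c) - c * ((z + z) * (z + z))
    ≡⟨ cong₂ _⊘_ (solve (c ∷ z ∷ []) ℚ-ring) (solve (c ∷ z ∷ []) ℚ-ring) ⟩
  2ℚ * (z * z + c) * (2ℚ * (z * z + c)) - 2ℚ * ((z * z - c) * (z * z - c))
    ⊘ (z * z - c) * (z * z - c)
    ≡⟨ f₋₂-⊘ _ _ ⟨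
  extend f₋₂ (τ c (fin z))
    ∎
  where
  open ≡-Reasoning
  nondegenerate : z + z ≡ 0ℚ → z * z + c ≢ 0ℚ
  nondegenerate z+z≡0 z²+c≡0 = c≢0 (begin
    c              ≡⟨ +-identityˡ c ⟨
    0ℚ * 0ℚ + c    ≡⟨ cong (λ u → u * u + c) (p+p≡0⇒p≡0 {z} z+z≡0) ⟨
    z * z + c      ≡⟨ z²+c≡0 ⟩
    0ℚ             ∎)

τ-semiconj : ∀ {b} → b ≢ 0ℚ → ∀ P → τ (b + b) (φ b P) ≡ extend f₋₂ (τ (b + b) P)
τ-semiconj b≢0 ∞       = refl
τ-semiconj {b} b≢0 (fin z) = trans (cong (τ (b + b)) (φ-newton b z)) (τ-newton (p+p≢0 b≢0) z)

φ-odd : ∀ b P → φ b (neg P) ≡ neg (φ b P)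
φ-odd b ∞       = refl
φ-odd b (fin z) = begin
  φ b (fin (- z))          ≡⟨ φ-newton b (- z) ⟩
  newton (b + b) (- z)     ≡⟨ newton-odd (b + b) z ⟩
  neg (newton (b + b) z)   ≡⟨ cong neg (φ-newton b z) ⟨
  neg (φ b (fin z))        ∎
  where open ≡-Reasoning

τ-∞≢τ-fin : ∀ {c} → c ≢ 0ℚ → ∀ w → τ c ∞ ≢ τ c (fin w)
τ-∞≢τ-fin {c} c≢0 w eq = p+p≢0 (p+p≢0 c≢0) (begin
  c + c + (c + c)                           ≡⟨ solve (c ∷ w ∷ []) ℚ-ring ⟩
  2ℚ * (w * w + c) * 1ℚ - 2ℚ * (w * w - c)  ≡⟨ x≈y⇒x∙y⁻¹≈ε (sym cross) ⟩
  0ℚ                                        ∎)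
  where
  open ≡-Reasoning
  -- τ c ∞ = fin 2ℚ is definitionally 2ℚ ⊘ 1ℚ.
  cross : 2ℚ * (w * w - c) ≡ 2ℚ * (w * w + c) * 1ℚ
  cross = ⊘-cross {2ℚ} {1ℚ} {2ℚ * (w * w + c)} {w * w - c} eq

τ-fin-injective : ∀ {c} → c ≢ 0ℚ → ∀ z w → τ c (fin z) ≡ τ c (fin w) → z * z ≡ w * w
τ-fin-injective {c} c≢0 z w eq =
  [ ⊥-elim ∘ p+p≢0 (p+p≢0 c≢0) , sym ∘ x∙y⁻¹≈ε⇒x≈y (w * w) (z * z) ] (p*q≡0⇒p≡0∨q≡0 _ _ (begin
    (c + c + (c + c)) * (w * w - z * z)                             ≡⟨ solve (c ∷ z ∷ w ∷ []) ℚ-ring ⟩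
    2ℚ * (z * z + c) * (w * w - c) - 2ℚ * (w * w + c) * (z * z - c) ≡⟨ x≈y⇒x∙y⁻¹≈ε cross ⟩
    0ℚ                                                              ∎))
  where
  open ≡-Reasoning
  cross : 2ℚ * (z * z + c) * (w * w - c) ≡ 2ℚ * (w * w + c) * (z * z - c)
  cross = ⊘-cross {2ℚ * (z * z + c)} {z * z - c} {2ℚ * (w * w + c)} {w * w - c} eq

τ-fibre : ∀ {c} → c ≢ 0ℚ → ∀ P Q → τ c P ≡ τ c Q → P ≡ Q ⊎ P ≡ neg Q
τ-fibre c≢0 ∞       ∞       _  = inj₁ refl
τ-fibre c≢0 ∞       (fin w) eq = ⊥-elim (τ-∞≢τ-fin c≢0 w eq)
τ-fibre c≢0 (fin z) ∞       eq = ⊥-elim (τ-∞≢τ-fin c≢0 z (sym eq))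
τ-fibre c≢0 (fin z) (fin w) eq =
  Sum.map (cong fin) (cong fin) (p*p≡q*q⇒p≡q∨p≡-q z w (τ-fin-injective c≢0 z w eq))

φ-periodic⇒period≤2 : ∀ {b} → b ≢ 0ℚ → ∀ {α} → Periodic (φ b) α → φ b α ≡ α ⊎ φ b (φ b α) ≡ α
φ-periodic⇒period≤2 {b} b≢0 {α} per = Sum.map id period-two (τ-fibre (p+p≢0 b≢0) _ _ τ-invariant)
  where
  open ≡-Reasoning
  τ-invariant : τ (b + b) (φ b α) ≡ τ (b + b) α
  τ-invariant = trans (τ-semiconj b≢0 α)
    (extend-periodic⇒fixed f₋₂-periodic⇒fixed _
      (periodic-semiconj {f = φ b} {g = extend f₋₂} (τ (b + b)) (τ-semiconj b≢0) per))
  period-two : φ b α ≡ neg α → φ b (φ b α) ≡ α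
  period-two φα≡-α = begin
    φ b (φ b α)   ≡⟨ cong (φ b) φα≡-α ⟩
    φ b (neg α)   ≡⟨ φ-odd b α ⟩
    neg (φ b α)   ≡⟨ cong neg φα≡-α ⟩
    neg (neg α)   ≡⟨ neg-involutive α ⟩
    α             ∎

theorem5p1 : (b : ℚ) → b ≢ 0ℚ → (α : ℙ¹) (n : ℕ) → 2 ℕ.< n → ¬ HasLeastPeriod (φ b) α n
theorem5p1 b b≢0 α (suc m) 2<n (_ , φⁿα≡α , minimal) =
  [ minimal 1 (s≤s z≤n) (ℕ.<-trans (s≤s (s≤s z≤n)) 2<n) , minimal 2 (s≤s z≤n) 2<n ]
    (φ-periodic⇒period≤2 b≢0 (m , φⁿα≡α))
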